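{- The set $\mathrm{Sort}(\mathfrak{s}_{\underline{13}2})=\bigcup_{n\ge1}\mathrm{Sort}_n(\mathfrak{s}_{\underline{13}2})$ is not a permutation class: $2413\in\mathrm{Sort}(\mathfrak{s}_{\underline{13}2})$ contains $132$, but $132\notin\mathrm{Sort}(\mathfrak{s}_{\underline{13}2})$.
   Context: A permutation class is a set of permutations closed under (classical) pattern containment. A pattern is a permutation $\sigma$ in which some blocks of consecutive entries may be underlined; a sequence contains it if it has a subsequence order-isomorphic to $\sigma$ whose entries corresponding to a common underlined block are adjacent in the sequence. Pattern-avoiding stack map $\mathfrak{s}_\sigma$: process input $\tau_1,\dots,\tau_n$ in order; when $\tau_i$ is next, while the stack is nonempty and the sequence formed by placing $\tau_i$ on top of the stack, read top to bottom, contains $\sigma$ (underlined entries adjacent in the stack), pop the top entry to the output; then push $\tau_i$; at the end pop all remaining entries top to bottom to the output. $\mathrm{Sort}_n(\mathfrak{s}_\sigma)$ is the set of $\tau\in\mathfrak S_n$ such that $\mathfrak{s}_\sigma(\tau)$ avoids $231$. -}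

module Defs where

open import Data.Nat using (ℕ; zero; suc; _<_; _≤_)
open import Data.Fin using (Fin; toℕ) renaming (_<_ to _<ᶠ_)
open import Data.List using (List; []; _∷_; _++_; [_]; length; lookup; map; upTo)
open import Data.List.Membership.Propositional using (_∈_)
open import Data.List.Relation.Binary.Permutation.Propositional using (_↭_)
open import Data.Product using (Σ; _×_; ∃)
open import Data.Sum using (_⊎_)
open import Function.Bundles using (_⇔_)
open import Relation.Nullary using (¬_)
open import Relation.Binary.PropositionalEquality using (_≡_)

IsPerm : List ℕ → Set
IsPerm τ = τ ↭ map suc (upTo (length τ))

-- A (possibly underlined) pattern: the underlying permutation together with
-- the list of positions i (0-based) such that entries i and i+1 of the
-- pattern lie in a common underlined block (so must be adjacent).
record UPattern : Set where
  constructor mkPat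
  field
    perm : List ℕ
    adj  : List ℕ
open UPattern public

record Occurrence (p : UPattern) (w : List ℕ) : Set where
  field
    pos      : Fin (length (perm p)) → Fin (length w)
    increasing : ∀ i j → i <ᶠ j → pos i <ᶠ pos j
    orderIso : ∀ i j → (lookup (perm p) i < lookup (perm p) j)
                       ⇔ (lookup w (pos i) < lookup w (pos j))
    adjacent : ∀ i j → toℕ i ∈ adj p → toℕ j ≡ suc (toℕ i)
                     → toℕ (pos j) ≡ suc (toℕ (pos i))

Contains : List ℕ → UPattern → Set
Contains w p = Occurrence p w

ContainsClassical : List ℕ → List ℕ → Set
ContainsClassical w σ = Contains w (mkPat σ [])

Avoids231 : List ℕ → Set
Avoids231 w = ¬ ContainsClassical w (2 ∷ 3 ∷ 1 ∷ [])

-- The pattern-avoiding stack map, as its (functional) graph.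
-- StackRun p input stack outputSoFar finalOutput
-- The stack is a list whose head is the top of the stack.
data StackRun (p : UPattern) : List ℕ → List ℕ → List ℕ → List ℕ → Set where
  pop  : ∀ {x inp s st out r} →
         Contains (x ∷ s ∷ st) p →
         StackRun p (x ∷ inp) st (out ++ [ s ]) r →
         StackRun p (x ∷ inp) (s ∷ st) out r
  push : ∀ {x inp st out r} →
         (st ≡ [] ⊎ ¬ Contains (x ∷ st) p) →
         StackRun p inp (x ∷ st) out r →
         StackRun p (x ∷ inp) st out r
  done : ∀ {st out} →
         StackRun p [] st out (out ++ st)

StackMap : UPattern → List ℕ → List ℕ → Set
StackMap p τ ρ = StackRun p τ [] [] ρ

InSort : UPattern → List ℕ → Set
InSort p τ = (1 ≤ length τ) × IsPerm τ × Σ (List ℕ) (λ ρ → StackMap p τ ρ × Avoids231 ρ)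

IsPermClass : (List ℕ → Set) → Set
IsPermClass C = ∀ τ π → C τ → 1 ≤ length π → IsPerm π → ContainsClassical τ π → C π

pat-u13-2 : UPattern
pat-u13-2 = mkPat (1 ∷ 3 ∷ 2 ∷ []) (0 ∷ [])

{-# OPTIONS --safe #-}
-- Running the stack map by hand: s(2413) = 4312 avoids 231, while s(132) = 231.
-- Since the stack map is deterministic, the latter shows 132 is not sortable,
-- although 132 occurs in the sortable permutation 2413.
module Submission where

open import Defs
open import Data.Nat using (ℕ; suc; _<_; _≤_; _≟_; z≤n; s≤s)
import Data.Nat as ℕ
open import Data.Fin using (Fin; toℕ) renaming (zero to fzero; suc to fsuc; _<_ to _<ᶠ_)
open import Data.Fin.Properties using (all?) renaming (_<?_ to _<ᶠ?_)
open import Data.List using (List; []; _∷_; length; lookup)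
open import Data.List.Membership.Propositional using (_∈_)
open import Data.List.Membership.DecPropositional _≟_ using (_∈?_)
open import Data.List.Relation.Unary.Any using (here)
open import Data.List.Relation.Binary.Permutation.Propositional
  using (refl; prep; swap; module PermutationReasoning)
open import Data.Product using (_×_; _,_; Σ-syntax)
open import Data.Sum using (inj₁; inj₂)
open import Function.Bundles using (_⇔_; mk⇔; Equivalence)
open import Relation.Nullary using (¬_; Dec; contradiction)
open import Relation.Nullary.Decidable
  using (True; toWitness; map′; _×-dec_; _→-dec_; ¬?)
open import Relation.Binary.PropositionalEquality using (_≡_) renaming (refl to ≡-refl)

_⇔-dec_ : ∀ {A B : Set} → Dec A → Dec B → Dec (A ⇔ B)
a? ⇔-dec b? = map′ (λ (f , g) → mk⇔ f g)
                   (λ e → Equivalence.to e , Equivalence.from e)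
                   ((a? →-dec b?) ×-dec (b? →-dec a?))

module _ (p : UPattern) (w : List ℕ) (pos : Fin (length (perm p)) → Fin (length w)) where

  increasing? : Dec (∀ i j → i <ᶠ j → pos i <ᶠ pos j)
  increasing? = all? λ i → all? λ j → (i <ᶠ? j) →-dec (pos i <ᶠ? pos j)

  orderIso? : Dec (∀ i j → (lookup (perm p) i < lookup (perm p) j)
                           ⇔ (lookup w (pos i) < lookup w (pos j)))
  orderIso? = all? λ i → all? λ j →
    (lookup (perm p) i ℕ.<? lookup (perm p) j) ⇔-dec (lookup w (pos i) ℕ.<? lookup w (pos j))

  adjacent? : Dec (∀ i j → toℕ i ∈ adj p → toℕ j ≡ suc (toℕ i)
                         → toℕ (pos j) ≡ suc (toℕ (pos i)))
  adjacent? = all? λ i → all? λ j →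
    (toℕ i ∈? adj p) →-dec ((toℕ j ≟ suc (toℕ i)) →-dec (toℕ (pos j) ≟ suc (toℕ (pos i))))

  occurrence : True increasing? → True orderIso? → True adjacent? → Contains w p
  occurrence inc iso adj = record
    { pos = pos
    ; increasing = toWitness inc
    ; orderIso = toWitness iso
    ; adjacent = toWitness adj
    }

module _ {n : ℕ} {T : Fin n → Fin n → Fin n → Set} where

  noTriple? : (∀ a b c → Dec (T a b c)) → Dec (∀ a b c → ¬ T a b c)
  noTriple? T? = all? λ a → all? λ b → all? λ c → ¬? (T? a b c)

Triple-u13-2 : (w : List ℕ) → (a b c : Fin (length w)) → Set
Triple-u13-2 w a b c = toℕ b ≡ suc (toℕ a) × toℕ b < toℕ c
                     × lookup w a < lookup w c × lookup w c < lookup w b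

triple-u13-2? : ∀ w a b c → Dec (Triple-u13-2 w a b c)
triple-u13-2? w a b c = (toℕ b ≟ suc (toℕ a)) ×-dec (toℕ b ℕ.<? toℕ c)
                      ×-dec (lookup w a ℕ.<? lookup w c) ×-dec (lookup w c ℕ.<? lookup w b)

Triple-231 : (w : List ℕ) → (a b c : Fin (length w)) → Set
Triple-231 w a b c = toℕ a < toℕ b × toℕ b < toℕ c
                   × lookup w a < lookup w b × lookup w c < lookup w a

triple-231? : ∀ w a b c → Dec (Triple-231 w a b c)
triple-231? w a b c = (toℕ a ℕ.<? toℕ b) ×-dec (toℕ b ℕ.<? toℕ c)
                    ×-dec (lookup w a ℕ.<? lookup w b) ×-dec (lookup w c ℕ.<? lookup w a)

module _ {w : List ℕ} where

  private
    i₀ i₁ i₂ : Fin 3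
    i₀ = fzero
    i₁ = fsuc fzero
    i₂ = fsuc (fsuc fzero)

  contains-u13-2⇒triple : Contains w pat-u13-2 → Σ[ a ∈ _ ] Σ[ b ∈ _ ] Σ[ c ∈ _ ] Triple-u13-2 w a b c
  contains-u13-2⇒triple o = pos i₀ , pos i₁ , pos i₂
    , adjacent i₀ i₁ (here ≡-refl) ≡-refl
    , increasing i₁ i₂ (s≤s (s≤s z≤n))
    , Equivalence.to (orderIso i₀ i₂) (s≤s (s≤s z≤n))
    , Equivalence.to (orderIso i₂ i₁) (s≤s (s≤s (s≤s z≤n)))
    where open Occurrence o

  contains-231⇒triple : ContainsClassical w (2 ∷ 3 ∷ 1 ∷ []) → Σ[ a ∈ _ ] Σ[ b ∈ _ ] Σ[ c ∈ _ ] Triple-231 w a b c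
  contains-231⇒triple o = pos i₀ , pos i₁ , pos i₂
    , increasing i₀ i₁ (s≤s z≤n)
    , increasing i₁ i₂ (s≤s (s≤s z≤n))
    , Equivalence.to (orderIso i₀ i₁) (s≤s (s≤s (s≤s z≤n)))
    , Equivalence.to (orderIso i₂ i₀) (s≤s (s≤s z≤n))
    where open Occurrence o

avoids-u13-2 : ∀ w → True (noTriple? (triple-u13-2? w)) → ¬ Contains w pat-u13-2
avoids-u13-2 w none o with contains-u13-2⇒triple o
... | a , b , c , t = toWitness none a b c t

avoids-231 : ∀ w → True (noTriple? (triple-231? w)) → Avoids231 w
avoids-231 w none o with contains-231⇒triple o
... | a , b , c , t = toWitness none a b c t

-- A pop and a push never compete: pop needs an occurrence that push forbids.
stackRun-functional : ∀ {p inp st out r r′} →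
  StackRun p inp st out r → StackRun p inp st out r′ → r ≡ r′
stackRun-functional (pop _ run) (pop _ run′) = stackRun-functional run run′
stackRun-functional (pop _ _) (push (inj₁ ()) _)
stackRun-functional (pop occ _) (push (inj₂ ¬occ) _) = contradiction occ ¬occ
stackRun-functional (push (inj₁ ()) _) (pop _ _)
stackRun-functional (push (inj₂ ¬occ) _) (pop occ _) = contradiction occ ¬occ
stackRun-functional (push _ run) (push _ run′) = stackRun-functional run run′
stackRun-functional done done = ≡-refl

¬InSort-of-image : ∀ {p τ ρ} → StackMap p τ ρ → ¬ Avoids231 ρ → ¬ InSort p τ
¬InSort-of-image run ¬avoids (_ , _ , ρ′ , run′ , avoids) rewrite stackRun-functional run run′ =
  ¬avoids avoids

¬IsPermClass-by-witness : ∀ {C : List ℕ → Set} τ π → C τ → 1 ≤ length π → IsPerm π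
  → ContainsClassical τ π → ¬ C π → ¬ IsPermClass C
¬IsPermClass-by-witness τ π τ∈C len π-perm τ⊇π π∉C closed = π∉C (closed τ π τ∈C len π-perm τ⊇π)

stackMap-2413 : StackMap pat-u13-2 (2 ∷ 4 ∷ 1 ∷ 3 ∷ []) (4 ∷ 3 ∷ 1 ∷ 2 ∷ [])
stackMap-2413 =
  push (inj₁ ≡-refl)
    (push (inj₂ (avoids-u13-2 _ _))
      (pop (occurrence _ _ (λ i → i) _ _ _)
        (push (inj₂ (avoids-u13-2 _ _))
          (push (inj₂ (avoids-u13-2 _ _))
            done))))

stackMap-132 : StackMap pat-u13-2 (1 ∷ 3 ∷ 2 ∷ []) (2 ∷ 3 ∷ 1 ∷ [])
stackMap-132 =
  push (inj₁ ≡-refl)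
    (push (inj₂ (avoids-u13-2 _ _))
      (push (inj₂ (avoids-u13-2 _ _))
        done))

isPerm-2413 : IsPerm (2 ∷ 4 ∷ 1 ∷ 3 ∷ [])
isPerm-2413 = begin
  2 ∷ 4 ∷ 1 ∷ 3 ∷ []  ↭⟨ prep 2 (swap 4 1 refl) ⟩
  2 ∷ 1 ∷ 4 ∷ 3 ∷ []  ↭⟨ swap 2 1 refl ⟩
  1 ∷ 2 ∷ 4 ∷ 3 ∷ []  ↭⟨ prep 1 (prep 2 (swap 4 3 refl)) ⟩
  1 ∷ 2 ∷ 3 ∷ 4 ∷ []  ∎
  where open PermutationReasoning

isPerm-132 : IsPerm (1 ∷ 3 ∷ 2 ∷ [])
isPerm-132 = prep 1 (swap 3 2 refl)

2413-contains-132 : ContainsClassical (2 ∷ 4 ∷ 1 ∷ 3 ∷ []) (1 ∷ 3 ∷ 2 ∷ [])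
2413-contains-132 = occurrence _ _ positions _ _ _
  where
  positions : Fin 3 → Fin 4
  positions fzero = fzero
  positions (fsuc fzero) = fsuc fzero
  positions (fsuc (fsuc fzero)) = fsuc (fsuc (fsuc fzero))

2413-sortable : InSort pat-u13-2 (2 ∷ 4 ∷ 1 ∷ 3 ∷ [])
2413-sortable = s≤s z≤n , isPerm-2413 , _ , stackMap-2413 , avoids-231 _ _

132-unsortable : ¬ InSort pat-u13-2 (1 ∷ 3 ∷ 2 ∷ [])
132-unsortable = ¬InSort-of-image stackMap-132 (λ avoids → avoids (occurrence _ _ (λ i → i) _ _ _))

mainTheorem11 : ¬ IsPermClass (InSort pat-u13-2)
                × InSort pat-u13-2 (2 ∷ 4 ∷ 1 ∷ 3 ∷ [])
                × ContainsClassical (2 ∷ 4 ∷ 1 ∷ 3 ∷ []) (1 ∷ 3 ∷ 2 ∷ [])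
                × ¬ InSort pat-u13-2 (1 ∷ 3 ∷ 2 ∷ [])
mainTheorem11 =
  ¬IsPermClass-by-witness _ _ 2413-sortable (s≤s z≤n) isPerm-132 2413-contains-132 132-unsortable
  , 2413-sortable , 2413-contains-132 , 132-unsortable
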